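{- Let $A$ be a quasi-local residuated lattice and $F$ a filter of $A$. Then $A/F$ is quasi-local.
   Context: A (commutative) residuated lattice is an algebra $(A,\vee,\wedge,\odot,\rightarrow,0,1)$ such that $(A,\vee,\wedge,0,1)$ is a bounded lattice, $(A,\odot,1)$ is a commutative monoid, and for all $a,b,c\in A$: $a\le b\rightarrow c$ iff $a\odot b\le c$. Write $\neg a=a\rightarrow 0$ and $a^n$ for the $n$-fold $\odot$-product of $a$. A filter is a nonempty subset closed under $\odot$ and upward closed; $A/F$ is the quotient by the congruence $a\equiv b$ iff $(a\rightarrow b)\wedge(b\rightarrow a)\in F$. $B(L)$ is the set of complemented elements of the lattice of $L$. A residuated lattice $L$ is quasi-local iff for every $a\in L$ there exist $e\in B(L)$ and $n\ge1$ such that $a^n\odot e=0$ and $(\neg a)^n\odot(\neg e)=0$. -}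

module Defs where

open import Level using (Level; _⊔_; suc)
open import Data.Nat using (ℕ; zero; suc; _≤_)
open import Data.Product using (Σ; _×_; ∃)
open import Relation.Binary.PropositionalEquality using (_≡_)
open import Algebra.Lattice.Structures using (IsLattice)
open import Algebra.Structures using (IsCommutativeMonoid)
open import Relation.Unary using (Pred; _∈_)

-- Instantiated with _≡_ for an algebra A itself,
-- and with the filter congruence for a quotient A/F (a setoid quotient:
-- same carrier and operations, coarser equality).
record RLSignature (a ℓ : Level) : Set (Level.suc (a ⊔ ℓ)) where
  infix  4 _≈_
  infixr 5 _⇒_
  infixr 6 _∨_
  infixr 7 _∧_
  infixr 8 _⊙_
  field
    Carrier : Set a
    _≈_     : Carrier → Carrier → Set ℓ
    _∨_     : Carrier → Carrier → Carrier
    _∧_     : Carrier → Carrier → Carrier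
    _⊙_     : Carrier → Carrier → Carrier
    _⇒_     : Carrier → Carrier → Carrier
    𝟘       : Carrier
    𝟙       : Carrier

  neg : Carrier → Carrier
  neg x = x ⇒ 𝟘

  _^_ : Carrier → ℕ → Carrier
  x ^ zero  = 𝟙
  x ^ suc n = x ⊙ (x ^ n)

  Complemented : Carrier → Set (a ⊔ ℓ)
  Complemented e = ∃ λ f → ((e ∨ f) ≈ 𝟙) × ((e ∧ f) ≈ 𝟘)

  QuasiLocal : Set (a ⊔ ℓ)
  QuasiLocal = ∀ x → ∃ λ e → Complemented e × ∃ λ n → (1 ≤ n) ×
                 ((x ^ n) ⊙ e ≈ 𝟘) × ((neg x ^ n) ⊙ neg e ≈ 𝟘)

record ResiduatedLattice (a : Level) : Set (Level.suc a) where
  infixr 5 _⇒_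
  infixr 6 _∨_
  infixr 7 _∧_
  infixr 8 _⊙_
  field
    Carrier : Set a
    _∨_     : Carrier → Carrier → Carrier
    _∧_     : Carrier → Carrier → Carrier
    _⊙_     : Carrier → Carrier → Carrier
    _⇒_     : Carrier → Carrier → Carrier
    𝟘       : Carrier
    𝟙       : Carrier
  _≤ᴸ_ : Carrier → Carrier → Set a
  x ≤ᴸ y = (x ∧ y) ≡ x
  field
    isLattice            : IsLattice _≡_ _∨_ _∧_
    bottom               : ∀ x → 𝟘 ≤ᴸ x
    top                  : ∀ x → x ≤ᴸ 𝟙
    isCommutativeMonoid  : IsCommutativeMonoid _≡_ _⊙_ 𝟙
    residuation₁         : ∀ x y z → x ≤ᴸ (y ⇒ z) → (x ⊙ y) ≤ᴸ z
    residuation₂         : ∀ x y z → (x ⊙ y) ≤ᴸ z → x ≤ᴸ (y ⇒ z)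

  sig : RLSignature a a
  sig = record { Carrier = Carrier ; _≈_ = _≡_ ; _∨_ = _∨_ ; _∧_ = _∧_
               ; _⊙_ = _⊙_ ; _⇒_ = _⇒_ ; 𝟘 = 𝟘 ; 𝟙 = 𝟙 }

module _ {a : Level} (A : ResiduatedLattice a) where
  open ResiduatedLattice A

  record IsFilter {ℓ : Level} (F : Pred Carrier ℓ) : Set (a ⊔ ℓ) where
    field
      nonempty  : ∃ λ x → x ∈ F
      ⊙-closed  : ∀ {x y} → x ∈ F → y ∈ F → (x ⊙ y) ∈ F
      up-closed : ∀ {x y} → x ∈ F → x ≤ᴸ y → y ∈ F

  _/_ : {ℓ : Level} (F : Pred Carrier ℓ) → RLSignature a ℓ
  _/_ F = record
    { Carrier = Carrier
    ; _≈_ = λ x y → ((x ⇒ y) ∧ (y ⇒ x)) ∈ F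
    ; _∨_ = _∨_ ; _∧_ = _∧_ ; _⊙_ = _⊙_ ; _⇒_ = _⇒_ ; 𝟘 = 𝟘 ; 𝟙 = 𝟙 }

module Submission where

-- The quotient A/F of Defs is a setoid quotient: it keeps the carrier and
-- all operations of A and only replaces equality by the filter congruence
--   x ≡_F y  iff  (x ⇒ y) ∧ (y ⇒ x) ∈ F.
-- Quasi-locality asks for witnesses e, f, n satisfying finitely many
-- equations built from the operations.  Hence
--   (1) for any relation R on the carrier, powers computed in
--       "A with equality R" coincide with the powers of A, and so every
--       quasi-locality witness of A is one of "A with equality R" as soon
--       as R contains equality (i.e. R is reflexive);
--   (2) the filter congruence is reflexive, because 1 ∈ F and 1 ≤ x ⇒ x.
-- The theorem is (1) applied to R = ≡_F, using (2).

open import Defs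
open import Level using (Level)
open import Relation.Unary using (Pred; _∈_)
open import Data.Nat using (zero; suc)
open import Data.Product using (_,_; proj₁; proj₂)
open import Relation.Binary.PropositionalEquality
  using (_≡_; refl; sym; trans; cong; subst)
open import Algebra.Lattice.Bundles using (Lattice)
import Algebra.Lattice.Properties.Lattice as LatticeProperties
open import Algebra.Structures using (IsCommutativeMonoid)

module _ {a : Level} (A : ResiduatedLattice a) where
  open ResiduatedLattice A
  open RLSignature using (QuasiLocal)

  -- A with its equality replaced by an arbitrary relation R; the quotient
  -- A / F is (definitionally) the instance R = ≡_F.
  withEquality : {ℓ : Level} → (Carrier → Carrier → Set ℓ) → RLSignature a ℓ
  withEquality R = record
    { Carrier = Carrier ; _≈_ = R ; _∨_ = _∨_ ; _∧_ = _∧_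
    ; _⊙_ = _⊙_ ; _⇒_ = _⇒_ ; 𝟘 = 𝟘 ; 𝟙 = 𝟙 }

  -- Powers only involve ⊙ and 1, so they do not depend on the equality.
  ^-withEquality : {ℓ : Level} (R : Carrier → Carrier → Set ℓ) →
    ∀ x n → RLSignature._^_ (withEquality R) x n ≡ RLSignature._^_ sig x n
  ^-withEquality R x zero    = refl
  ^-withEquality R x (suc n) = cong (x ⊙_) (^-withEquality R x n)

  quasiLocal-withEquality : {ℓ : Level} (R : Carrier → Carrier → Set ℓ) →
    (∀ x → R x x) → QuasiLocal sig → QuasiLocal (withEquality R)
  quasiLocal-withEquality R R-refl ql x
    with ql x
  ... | e , (f , e∨f≡1 , e∧f≡0) , n , 1≤n , xⁿe≡0 , ¬xⁿ¬e≡0 =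
    e , (f , ≡⇒R e∨f≡1 , ≡⇒R e∧f≡0) , n , 1≤n ,
    ≡⇒R (trans (cong (_⊙ e) (^-withEquality R x n)) xⁿe≡0) ,
    ≡⇒R (trans (cong (_⊙ neg e) (^-withEquality R (neg x) n)) ¬xⁿ¬e≡0)
    where
      open RLSignature sig using (neg)

      ≡⇒R : ∀ {y z} → y ≡ z → R y z
      ≡⇒R {y} refl = R-refl y

  module _ {ℓ : Level} {F : Pred Carrier ℓ} (isFilter : IsFilter A F) where
    open IsFilter isFilter

    lattice : Lattice a a
    lattice = record { Carrier = Carrier ; _≈_ = _≡_ ; _∨_ = _∨_ ; _∧_ = _∧_
                     ; isLattice = isLattice }

    -- A filter contains the top element 1, being nonempty and upward closed.
    𝟙∈F : 𝟙 ∈ F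
    𝟙∈F = up-closed (proj₂ nonempty) (top (proj₁ nonempty))

    -- 1 ≤ x ⇒ x, by residuation from 1 ⊙ x = x ≤ x.
    𝟙≤⇒-self : ∀ x → 𝟙 ≤ᴸ (x ⇒ x)
    𝟙≤⇒-self x = residuation₂ 𝟙 x x 𝟙⊙x≤x
      where
        𝟙⊙x≤x : (𝟙 ⊙ x) ≤ᴸ x
        𝟙⊙x≤x = subst (λ y → (y ∧ x) ≡ y)
                      (sym (IsCommutativeMonoid.identityˡ isCommutativeMonoid x))
                      (LatticeProperties.∧-idem lattice x)

    ≡F-refl : ∀ x → ((x ⇒ x) ∧ (x ⇒ x)) ∈ F
    ≡F-refl x = subst (_∈ F) (sym (LatticeProperties.∧-idem lattice (x ⇒ x)))
                      (up-closed 𝟙∈F (𝟙≤⇒-self x))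

proposition5p15 : {a ℓ : Level} (A : ResiduatedLattice a) (F : Pred (ResiduatedLattice.Carrier A) ℓ) →
    IsFilter A F → RLSignature.QuasiLocal (ResiduatedLattice.sig A) →
    RLSignature.QuasiLocal (A / F)
proposition5p15 A F isFilter =
  quasiLocal-withEquality A (λ x y → ((x ⇒ y) ∧ (y ⇒ x)) ∈ F) (≡F-refl A isFilter)
  where open ResiduatedLattice A using (_⇒_; _∧_)
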